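{- Let $G$ be a graph with at least one edge. Then the following are equivalent: (i) $q^*(G)=0$; (ii) $q_{\mathcal A}(G) \leq 0$ for each bipartition $\mathcal A$ of $V(G)$; (iii) $p_G(U) \leq 0$ for each $U \subset V(G)$, where $p_G(U) = 2e(U)\,{\rm vol}(G) - {\rm vol}(U)^2$.
   Context: For a graph $G=(V,E)$ with $m \geq 1$ edges and degrees $d_v$, for $A\subseteq V$ let ${\rm vol}(A)=\sum_{v\in A} d_v$ (so ${\rm vol}(G)={\rm vol}(V)=2m$) and let $e(A)$ be the number of edges with both ends in $A$. For a partition $\mathcal{A}$ of $V$, $q_{\mathcal A}(G)=\frac{1}{m}\sum_{A\in\mathcal A} e(A)-\frac{1}{4m^2}\sum_{A\in\mathcal A}{\rm vol}(A)^2$, and $q^*(G)=\max_{\mathcal A} q_{\mathcal A}(G)$ over all vertex partitions. A bipartition is a partition of $V$ into two parts. -}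

module Defs where

open import Data.Nat using (ℕ; zero; suc; _+_; _*_; NonZero; _<ᵇ_)
open import Data.Nat.Properties using (m*n≢0)
open import Data.Bool using (Bool; true; false; _∧_; if_then_else_)
open import Data.Fin using (Fin; toℕ; _≟_)
import Data.Fin as Fin
open import Data.Fin.Subset using (Subset)
open import Data.Vec using (lookup; tabulate)
open import Data.Integer using (+_; _-_)
open import Data.Rational using (ℚ; _/_)
import Data.Rational as ℚ
open import Relation.Nullary.Decidable using (⌊_⌋)
open import Relation.Binary.PropositionalEquality using (_≡_)
open import Function.Definitions using (Surjective)
open import Data.Product using (Σ; _×_; ∃)

record Graph (n : ℕ) : Set where
  field
    adj    : Fin n → Fin n → Bool
    sym    : ∀ u v → adj u v ≡ adj v u
    irrefl : ∀ v → adj v v ≡ false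
open Graph public

∑ : ∀ {n} → (Fin n → ℕ) → ℕ
∑ {zero}  f = 0
∑ {suc n} f = f Fin.zero + ∑ (λ i → f (Fin.suc i))

[_] : Bool → ℕ
[ b ] = if b then 1 else 0

module _ {n : ℕ} (G : Graph n) where

  deg : Fin n → ℕ
  deg v = ∑ (λ w → [ adj G v w ])

  vol : Subset n → ℕ
  vol A = ∑ (λ v → if lookup A v then deg v else 0)

  e : Subset n → ℕ
  e A = ∑ (λ v → ∑ (λ w → [ (toℕ v <ᵇ toℕ w) ∧ lookup A v ∧ lookup A w ∧ adj G v w ]))

  full : Subset n
  full = tabulate (λ _ → true)

  numEdges : ℕ
  numEdges = e full

  p : Subset n → Data.Integer.ℤ
  p U = + (2 * e U * vol full) - + (vol U * vol U)

-- A partition of V = Fin n into k parts, given by a labelling c : Fin n → Fin k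
-- whose parts (fibres) are all nonempty, i.e. c is surjective.
record Partition (n k : ℕ) : Set where
  field
    label : Fin n → Fin k
    onto  : Surjective _≡_ _≡_ label
open Partition public

part : ∀ {n k} → Partition n k → Fin k → Subset n
part P i = tabulate (λ v → ⌊ label P v ≟ i ⌋)

q : ∀ {n k} (G : Graph n) → .{{_ : NonZero (numEdges G)}} → Partition n k → ℚ
q G {{nz}} P =
  ((+ ∑ (λ i → e G (part P i))) / m)
  ℚ.- ((+ ∑ (λ i → vol G (part P i) * vol G (part P i))) / (4 * m * m))
  where
    m = numEdges G
    instance
      nz4m : NonZero (4 * m)
      nz4m = m*n≢0 4 m
      nz4mm : NonZero (4 * m * m)
      nz4mm = m*n≢0 (4 * m) m

MaxModularityIs : ∀ {n} (G : Graph n) → .{{_ : NonZero (numEdges G)}} → ℚ → Set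
MaxModularityIs {n} G x =
  (Σ ℕ λ k → Σ (Partition n k) λ P → q G P ≡ x)
  × (∀ k (P : Partition n k) → q G P ℚ.≤ x)

{-# OPTIONS --safe #-}
-- Multiplying by 4m² and using vol(G) = 2m, q_𝒜(G) ≤ 0 says Σ_{A∈𝒜} 2e(A)vol(G) ≤ Σ_{A∈𝒜} vol(A)²,
-- so p_G ≤ 0 on every part gives q_𝒜(G) ≤ 0 for every partition, while the one-part partition has
-- modularity 0. For U ⊆ V write a = 2e(U), b = 2e(V∖U) and c for the number of edges between U and
-- V∖U; then vol(U) = a + c, vol(V∖U) = b + c and vol(G) = a + b + 2c, and both q ≤ 0 for the
-- bipartition {U, V∖U} and p_G(U) ≤ 0 reduce to ab ≤ c². When U or V∖U is empty there is no such
-- bipartition, but then ab = 0.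
module Submission where

open import Defs hiding (sym)
open import Data.Nat using (ℕ; NonZero)
open import Data.Integer using (ℤ)
import Data.Integer as ℤ
open import Data.Rational using (0ℚ)
import Data.Rational as ℚ
open import Data.Fin.Subset using (Subset)
open import Data.Product using (_×_)
open import Function.Bundles using (_⇔_)

open import Level using (0ℓ)
open import Function.Base using (_∘_; flip; const)
open import Function.Bundles using (Equivalence; mk⇔)
open import Function.Definitions using (Surjective)
open import Function.Properties.Equivalence using (⇔-setoid)
open import Relation.Binary.PropositionalEquality
  using (_≡_; _≗_; refl; sym; trans; cong; cong₂; subst; subst₂; module ≡-Reasoning)
open import Relation.Binary.Definitions using (tri<; tri≈; tri>)
open import Relation.Nullary using (¬_; yes; no)
open import Relation.Nullary.Decidable using (⌊_⌋)
open import Data.Product using (Σ; ∃; _,_; proj₂)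
open import Data.Sum using (_⊎_; inj₁; inj₂)
open import Data.Bool using (Bool; true; false; not; _∧_; if_then_else_)
open import Data.Bool.Properties
  using (∧-zeroʳ; ∧-commutativeMonoid; not-involutive; not-injective; ¬-not; T-≡)
  renaming (_≟_ to _≟ᵇ_)
open import Data.Fin using (Fin; toℕ)
open import Data.Fin.Patterns using (0F; 1F)
open import Data.Fin.Subset using (∁)
import Data.Fin as Fin
import Data.Fin.Properties as FinP
open import Data.Vec using (lookup)
open import Data.Vec.Properties
  using (lookup∘tabulate; tabulate∘lookup; tabulate-cong; tabulate-∘; lookup-map)
open import Data.Nat using (zero; suc; _+_; _*_; _≤_; _<_; _<ᵇ_; z≤n)
import Data.Nat.Properties as ℕP
open import Data.Nat.Tactic.RingSolver using (solve-∀)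
import Data.Integer.Properties as ℤP
open import Data.Rational using (_/_; toℚᵘ)
import Data.Rational.Properties as ℚP
open import Data.Rational.Unnormalised using (ℚᵘ; *≤*; *≡*)
  renaming (_/_ to _/ᵘ_; _≃_ to _≃ᵘ_; _-_ to _-ᵘ_)
import Data.Rational.Unnormalised.Properties as ℚᵘP
open import Algebra.Bundles using (CommutativeMonoid)
import Algebra.Properties.CommutativeSemigroup
  (CommutativeMonoid.commutativeSemigroup ∧-commutativeMonoid) as ∧P
import Algebra.Properties.Semiring.Sum ℕP.+-*-semiring as Sum
import Relation.Binary.Reasoning.Setoid (⇔-setoid 0ℓ) as ⇔-Reasoning

open Equivalence using (to; from)

∑≡sum : ∀ {n} (f : Fin n → ℕ) → ∑ f ≡ Sum.sum f
∑≡sum {zero}  f = refl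
∑≡sum {suc n} f = cong (f 0F +_) (∑≡sum (f ∘ Fin.suc))

∑-cong : ∀ {n} {f g : Fin n → ℕ} → f ≗ g → ∑ f ≡ ∑ g
∑-cong {f = f} {g} f≗g = trans (∑≡sum f) (trans (Sum.sum-cong-≗ f≗g) (sym (∑≡sum g)))

∑-zero : ∀ n → ∑ {n} (λ _ → 0) ≡ 0
∑-zero n = trans (∑≡sum {n} (λ _ → 0)) (Sum.sum-replicate-zero n)

∑-distrib-+ : ∀ {n} (f g : Fin n → ℕ) → ∑ (λ i → f i + g i) ≡ ∑ f + ∑ g
∑-distrib-+ f g = trans (∑≡sum (λ i → f i + g i))
  (trans (Sum.∑-distrib-+ f g) (sym (cong₂ _+_ (∑≡sum f) (∑≡sum g))))

*-distribˡ-∑ : ∀ {n} c (f : Fin n → ℕ) → c * ∑ f ≡ ∑ (λ i → c * f i)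
*-distribˡ-∑ c f = trans (cong (c *_) (∑≡sum f))
  (trans (Sum.*-distribˡ-sum c f) (sym (∑≡sum (λ i → c * f i))))

*-distribʳ-∑ : ∀ {n} c (f : Fin n → ℕ) → ∑ f * c ≡ ∑ (λ i → f i * c)
*-distribʳ-∑ c f = trans (cong (_* c) (∑≡sum f))
  (trans (Sum.*-distribʳ-sum c f) (sym (∑≡sum (λ i → f i * c))))

∑-comm : ∀ {m n} (f : Fin m → Fin n → ℕ) → ∑ (λ i → ∑ (f i)) ≡ ∑ (λ j → ∑ (λ i → f i j))
∑-comm f = trans (∑∑≡sum∑ f) (trans (Sum.∑-comm f) (sym (∑∑≡sum∑ (flip f))))
  where
  ∑∑≡sum∑ : ∀ {m n} (g : Fin m → Fin n → ℕ) →
            ∑ (λ i → ∑ (g i)) ≡ Sum.sum (λ i → Sum.sum (g i))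
  ∑∑≡sum∑ g = trans (∑-cong (λ i → ∑≡sum (g i))) (∑≡sum (λ i → Sum.sum (g i)))

∑-mono-≤ : ∀ {n} {f g : Fin n → ℕ} → (∀ i → f i ≤ g i) → ∑ f ≤ ∑ g
∑-mono-≤ {zero}  f≤g = z≤n
∑-mono-≤ {suc n} f≤g = ℕP.+-mono-≤ (f≤g 0F) (∑-mono-≤ (f≤g ∘ Fin.suc))

<ᵇ-true : ∀ {m n} → m < n → (m <ᵇ n) ≡ true
<ᵇ-true = to T-≡ ∘ ℕP.<⇒<ᵇ

<ᵇ-false : ∀ {m n} → ¬ m < n → (m <ᵇ n) ≡ false
<ᵇ-false {m} {n} m≮n = ¬-not (m≮n ∘ ℕP.<ᵇ⇒< m n ∘ from T-≡)

[]-split-by-order : ∀ {n} (v w : Fin n) b → (v ≡ w → b ≡ false) →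
                    [ b ] ≡ [ (toℕ v <ᵇ toℕ w) ∧ b ] + [ (toℕ w <ᵇ toℕ v) ∧ b ]
[]-split-by-order v w b diagonal with FinP.<-cmp v w
... | tri< v<w _ w≮v rewrite <ᵇ-true v<w | <ᵇ-false w≮v = sym (ℕP.+-identityʳ [ b ])
... | tri> v≮w _ w<v rewrite <ᵇ-false v≮w | <ᵇ-true w<v = refl
... | tri≈ _ refl _ rewrite diagonal refl | ∧-zeroʳ (toℕ v <ᵇ toℕ v) = refl

toℚᵘ-/ : ∀ i d .{{_ : NonZero d}} → toℚᵘ (i / d) ≃ᵘ i /ᵘ d
toℚᵘ-/ i (suc d) = ℚP.toℚᵘ-fromℚᵘ (i /ᵘ suc d)

/-/-≤0⇔ : ∀ a b d d′ .{{_ : NonZero d}} .{{_ : NonZero d′}} →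
          (ℤ.+ a / d ℚ.- ℤ.+ b / d′) ℚ.≤ 0ℚ ⇔ a * d′ ≤ b * d
/-/-≤0⇔ a b d@(suc _) d′@(suc _) = mk⇔
  (λ diff≤0 → ℤP.drop‿+≤+ (subst₂ ℤ._≤_ (sym (ℤP.pos-* a d′)) (sym (ℤP.pos-* b d))
    (ℚᵘP.drop-*≤* (ℚᵘP.p-q≤0⇒p≤q {x} {y}
      (ℚᵘP.≤-respˡ-≃ toℚᵘ-difference (ℚP.toℚᵘ-mono-≤ diff≤0))))))
  (λ ad′≤bd → ℚP.toℚᵘ-cancel-≤ (ℚᵘP.≤-respˡ-≃ (ℚᵘP.≃-sym toℚᵘ-difference)
    (ℚᵘP.p≤q⇒p-q≤0 {x} {y}
      (*≤* (subst₂ ℤ._≤_ (ℤP.pos-* a d′) (ℤP.pos-* b d) (ℤ.+≤+ ad′≤bd))))))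
  where
  x y : ℚᵘ
  x = ℤ.+ a /ᵘ d
  y = ℤ.+ b /ᵘ d′
  toℚᵘ-difference : toℚᵘ (ℤ.+ a / d ℚ.- ℤ.+ b / d′) ≃ᵘ x -ᵘ y
  toℚᵘ-difference = ℚᵘP.≃-trans (ℚP.toℚᵘ-homo-+ (ℤ.+ a / d) (ℚ.- (ℤ.+ b / d′)))
    (ℚᵘP.+-cong (toℚᵘ-/ (ℤ.+ a) d)
      (ℚᵘP.≃-trans (ℚP.toℚᵘ-homo‿- (ℤ.+ b / d′)) (ℚᵘP.-‿cong (toℚᵘ-/ (ℤ.+ b) d′))))

/-/-≡0 : ∀ a b d d′ .{{_ : NonZero d}} .{{_ : NonZero d′}} →
         a * d′ ≡ b * d → ℤ.+ a / d ℚ.- ℤ.+ b / d′ ≡ 0ℚ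
/-/-≡0 a b d@(suc _) d′@(suc _) ad′≡bd = begin
  ℤ.+ a / d ℚ.- ℤ.+ b / d′  ≡⟨ cong (ℚ._-_ (ℤ.+ a / d)) (sym a/d≡b/d′) ⟩
  ℤ.+ a / d ℚ.- ℤ.+ a / d   ≡⟨ ℚP.+-inverseʳ (ℤ.+ a / d) ⟩
  0ℚ                        ∎
  where
  open ≡-Reasoning
  cross : ℤ.+ a ℤ.* ℤ.+ d′ ≡ ℤ.+ b ℤ.* ℤ.+ d
  cross = trans (sym (ℤP.pos-* a d′)) (trans (cong ℤ.+_ ad′≡bd) (ℤP.pos-* b d))
  a/d≡b/d′ : ℤ.+ a / d ≡ ℤ.+ b / d′
  a/d≡b/d′ = ℚP.toℚᵘ-injective (ℚᵘP.≃-trans (toℚᵘ-/ (ℤ.+ a) d)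
    (ℚᵘP.≃-trans (*≡* cross) (ℚᵘP.≃-sym (toℚᵘ-/ (ℤ.+ b) d′))))

*-cancelʳ-≤-⇔ : ∀ {a b} m .{{_ : NonZero m}} → a * m ≤ b * m ⇔ a ≤ b
*-cancelʳ-≤-⇔ {a} {b} m = mk⇔ (ℕP.*-cancelʳ-≤ a b m) (ℕP.*-monoˡ-≤ m)

bipartition-bound⇒ab≤c² : ∀ a b c →
  (a + b) * ((a + c) + (b + c)) ≤ (a + c) * (a + c) + (b + c) * (b + c) → a * b ≤ c * c
bipartition-bound⇒ab≤c² a b c bound =
  ℕP.*-cancelˡ-≤ 2 (ℕP.+-cancelˡ-≤ (a * a + b * b + 2 * (a * c) + 2 * (b * c)) _ _
    (subst₂ _≤_ (lhs a b c) (rhs a b c) bound))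
  where
  lhs : ∀ a b c → (a + b) * ((a + c) + (b + c))
                ≡ (a * a + b * b + 2 * (a * c) + 2 * (b * c)) + 2 * (a * b)
  lhs = solve-∀
  rhs : ∀ a b c → (a + c) * (a + c) + (b + c) * (b + c)
                ≡ (a * a + b * b + 2 * (a * c) + 2 * (b * c)) + 2 * (c * c)
  rhs = solve-∀

ab≤c²⇒part-bound : ∀ a b c → a * b ≤ c * c → a * ((a + c) + (b + c)) ≤ (a + c) * (a + c)
ab≤c²⇒part-bound a b c ab≤c² =
  subst₂ _≤_ (sym (lhs a b c)) (sym (rhs a c)) (ℕP.+-monoʳ-≤ (a * a + 2 * (a * c)) ab≤c²)
  where
  lhs : ∀ a b c → a * ((a + c) + (b + c)) ≡ (a * a + 2 * (a * c)) + a * b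
  lhs = solve-∀
  rhs : ∀ a c → (a + c) * (a + c) ≡ (a * a + 2 * (a * c)) + c * c
  rhs = solve-∀

module _ {n} (G : Graph n) where

  arcs : (Fin n → Bool) → (Fin n → Bool) → ℕ
  arcs f g = ∑ λ v → ∑ λ w → [ f v ∧ g w ∧ adj G v w ]

  arcs-cong : ∀ {f f′ g g′} → f ≗ f′ → g ≗ g′ → arcs f g ≡ arcs f′ g′
  arcs-cong f≗f′ g≗g′ =
    ∑-cong λ v → ∑-cong λ w → cong₂ (λ x y → [ x ∧ y ∧ adj G v w ]) (f≗f′ v) (g≗g′ w)

  arc-swap : ∀ (f g : Fin n → Bool) v w → f v ∧ g w ∧ adj G v w ≡ g w ∧ f v ∧ adj G w v
  arc-swap f g v w =
    trans (∧P.x∙yz≈y∙xz (f v) (g w) (adj G v w)) (cong (λ x → g w ∧ f v ∧ x) (Graph.sym G v w))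

  arcs-comm : ∀ (f g : Fin n → Bool) → arcs f g ≡ arcs g f
  arcs-comm f g = trans (∑-comm (λ v w → [ f v ∧ g w ∧ adj G v w ]))
                        (∑-cong λ w → ∑-cong λ v → cong [_] (arc-swap f g v w))

  arcs-splitʳ : ∀ (f g : Fin n → Bool) → arcs f (const true) ≡ arcs f g + arcs f (not ∘ g)
  arcs-splitʳ f g =
    trans (∑-cong λ v → trans (∑-cong (split v)) (∑-distrib-+ (into v) (out-of v)))
          (∑-distrib-+ (∑ ∘ into) (∑ ∘ out-of))
    where
    into out-of : Fin n → Fin n → ℕ
    into   v w = [ f v ∧ g w ∧ adj G v w ]
    out-of v w = [ f v ∧ not (g w) ∧ adj G v w ]
    split : ∀ v w → [ f v ∧ adj G v w ] ≡ into v w + out-of v w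
    split v w with f v | g w
    ... | false | _     = refl
    ... | true  | true  = sym (ℕP.+-identityʳ [ adj G v w ])
    ... | true  | false = refl

  vol≡arcs : ∀ A → vol G A ≡ arcs (lookup A) (const true)
  vol≡arcs A = ∑-cong degree
    where
    degree : ∀ v → (if lookup A v then deg G v else 0) ≡ ∑ λ w → [ lookup A v ∧ adj G v w ]
    degree v with lookup A v
    ... | true  = refl
    ... | false = sym (∑-zero n)

  2e≡arcs : ∀ A → 2 * e G A ≡ arcs (lookup A) (lookup A)
  2e≡arcs A = sym (begin
    arcs u u
      ≡⟨ ∑-cong (λ v → trans (∑-cong (λ w → []-split-by-order v w (b v w) (loopless v w)))
                            (∑-distrib-+ (forward v) (backward v))) ⟩
    ∑ (λ v → ∑ (forward v) + ∑ (backward v))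
      ≡⟨ ∑-distrib-+ (∑ ∘ forward) (∑ ∘ backward) ⟩
    e G A + ∑ (∑ ∘ backward)
      ≡⟨ cong (e G A +_) (trans (∑-comm backward) (∑-cong λ w → ∑-cong λ v →
           cong (λ x → [ (toℕ w <ᵇ toℕ v) ∧ x ]) (arc-swap u u v w))) ⟩
    e G A + e G A
      ≡⟨ cong (e G A +_) (sym (ℕP.+-identityʳ (e G A))) ⟩
    2 * e G A ∎)
    where
    open ≡-Reasoning
    u = lookup A
    b : Fin n → Fin n → Bool
    b v w = u v ∧ u w ∧ adj G v w
    forward backward : Fin n → Fin n → ℕ
    forward  v w = [ (toℕ v <ᵇ toℕ w) ∧ b v w ]
    backward v w = [ (toℕ w <ᵇ toℕ v) ∧ b v w ]
    loopless : ∀ v w → v ≡ w → b v w ≡ false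
    loopless v _ refl rewrite irrefl G v | ∧-zeroʳ (u v) = ∧-zeroʳ (u v)

  e-empty : ∀ A → (∀ v → lookup A v ≡ false) → e G A ≡ 0
  e-empty A A-empty = trans (∑-cong λ v → trans (∑-cong (no-edge v)) (∑-zero n)) (∑-zero n)
    where
    no-edge : ∀ v w → [ (toℕ v <ᵇ toℕ w) ∧ lookup A v ∧ lookup A w ∧ adj G v w ] ≡ 0
    no-edge v w rewrite A-empty v = cong [_] (∧-zeroʳ (toℕ v <ᵇ toℕ w))

  member-or-edgeless : ∀ A → (∃ λ v → lookup A v ≡ true) ⊎ e G A ≡ 0
  member-or-edgeless A with FinP.any? (λ v → lookup A v ≟ᵇ true)
  ... | yes member = inj₁ member
  ... | no  none   = inj₂ (e-empty A (λ v → ¬-not (none ∘ (v ,_))))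

  full-true : ∀ v → lookup (full G) v ≡ true
  full-true = lookup∘tabulate (const true)

  handshake : vol G (full G) ≡ 2 * numEdges G
  handshake = trans (vol≡arcs (full G))
    (trans (arcs-cong (λ _ → refl) (sym ∘ full-true)) (sym (2e≡arcs (full G))))

  vol-full≡vol+vol∁ : ∀ U → vol G (full G) ≡ vol G U + vol G (∁ U)
  vol-full≡vol+vol∁ U = trans (∑-cong split) (∑-distrib-+ (volume U) (volume (∁ U)))
    where
    volume : Subset n → Fin n → ℕ
    volume A v = if lookup A v then deg G v else 0
    split : ∀ v → volume (full G) v ≡ volume U v + volume (∁ U) v
    split v rewrite full-true v | lookup-map v not U with lookup U v
    ... | true  = sym (ℕP.+-identityʳ (deg G v))
    ... | false = refl

  cut : Subset n → ℕ
  cut U = arcs (lookup U) (not ∘ lookup U)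

  cut-∁ : ∀ U → cut (∁ U) ≡ cut U
  cut-∁ U = trans (arcs-cong ∁U≗not-U not-∁U≗U) (arcs-comm (not ∘ lookup U) (lookup U))
    where
    ∁U≗not-U : lookup (∁ U) ≗ not ∘ lookup U
    ∁U≗not-U v = lookup-map v not U
    not-∁U≗U : not ∘ lookup (∁ U) ≗ lookup U
    not-∁U≗U v = trans (cong not (∁U≗not-U v)) (not-involutive (lookup U v))

  vol≡2e+cut : ∀ U → vol G U ≡ 2 * e G U + cut U
  vol≡2e+cut U = trans (vol≡arcs U)
    (trans (arcs-splitʳ (lookup U) (lookup U)) (cong (_+ cut U) (sym (2e≡arcs U))))

  vol∁≡2e+cut : ∀ U → vol G (∁ U) ≡ 2 * e G (∁ U) + cut U
  vol∁≡2e+cut U = trans (vol≡2e+cut (∁ U)) (cong (2 * e G (∁ U) +_) (cut-∁ U))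

  vol-full≡2e+cut+2e∁+cut : ∀ U →
    vol G (full G) ≡ (2 * e G U + cut U) + (2 * e G (∁ U) + cut U)
  vol-full≡2e+cut+2e∁+cut U =
    trans (vol-full≡vol+vol∁ U) (cong₂ _+_ (vol≡2e+cut U) (vol∁≡2e+cut U))

  p≤0⇔ : ∀ U → p G U ℤ.≤ ℤ.0ℤ ⇔ 2 * e G U * vol G (full G) ≤ vol G U * vol G U
  p≤0⇔ U = mk⇔ (ℤP.drop‿+≤+ ∘ ℤP.i-j≤0⇒i≤j) (ℤP.i≤j⇒i-j≤0 ∘ ℤ.+≤+)

side : ∀ {n} → Subset n → Fin n → Fin 2
side U v = if lookup U v then 0F else 1F

bipartition : ∀ {n} (U : Subset n) →
              (∃ λ v → lookup U v ≡ true) → (∃ λ w → lookup U w ≡ false) → Partition n 2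
bipartition U (v , v∈U) (w , w∉U) = record { label = side U ; onto = both-sides }
  where
  both-sides : Surjective _≡_ _≡_ (side U)
  both-sides 0F = v , λ { refl → cong (if_then 0F else 1F) v∈U }
  both-sides 1F = w , λ { refl → cong (if_then 0F else 1F) w∉U }

module _ {n} (U : Subset n) (v∈U : ∃ λ v → lookup U v ≡ true) (w∉U : ∃ λ w → lookup U w ≡ false)
  where

  part-bipartition-0F : part (bipartition U v∈U w∉U) 0F ≡ U
  part-bipartition-0F = trans (tabulate-cong (λ v → side≟0F (lookup U v))) (tabulate∘lookup U)
    where
    side≟0F : ∀ x → ⌊ (if x then 0F else 1F) Fin.≟ 0F ⌋ ≡ x
    side≟0F true  = refl
    side≟0F false = refl

  part-bipartition-1F : part (bipartition U v∈U w∉U) 1F ≡ ∁ U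
  part-bipartition-1F = trans (tabulate-cong (λ v → side≟1F (lookup U v)))
    (trans (tabulate-∘ not (lookup U)) (cong ∁ (tabulate∘lookup U)))
    where
    side≟1F : ∀ x → ⌊ (if x then 0F else 1F) Fin.≟ 1F ⌋ ≡ not x
    side≟1F true  = refl
    side≟1F false = refl

whole : ∀ {n} → Partition (suc n) 1
whole = record { label = const 0F ; onto = λ { 0F → 0F , const refl } }

instance
  4*m*m≢0 : ∀ {m} .{{_ : NonZero m}} → NonZero (4 * m * m)
  4*m*m≢0 {m} = ℕP.m*n≢0 (4 * m) m {{ℕP.m*n≢0 4 m}}

module _ {n} (G : Graph n) .{{_ : NonZero (numEdges G)}} where

  private
    m V : ℕ
    m = numEdges G
    V = vol G (full G)

  q≤0⇔ : ∀ {k} (P : Partition n k) →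
         q G P ℚ.≤ 0ℚ
         ⇔ 2 * ∑ (λ i → e G (part P i)) * V ≤ ∑ (λ i → vol G (part P i) * vol G (part P i))
  q≤0⇔ P = begin
    q G P ℚ.≤ 0ℚ           ≈⟨ /-/-≤0⇔ Σe Σvol² m (4 * m * m) ⟩
    Σe * (4 * m * m) ≤ Σvol² * m ≡⟨ cong (_≤ Σvol² * m) scale ⟩
    2 * Σe * V * m ≤ Σvol² * m   ≈⟨ *-cancelʳ-≤-⇔ m ⟩
    2 * Σe * V ≤ Σvol²           ∎
    where
    open ⇔-Reasoning
    Σe Σvol² : ℕ
    Σe    = ∑ (λ i → e G (part P i))
    Σvol² = ∑ (λ i → vol G (part P i) * vol G (part P i))
    scale : Σe * (4 * m * m) ≡ 2 * Σe * V * m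
    scale = trans (identity Σe m) (cong (λ x → 2 * Σe * x * m) (sym (handshake G)))
      where
      identity : ∀ s m → s * (4 * m * m) ≡ 2 * s * (2 * m) * m
      identity = solve-∀

  partitions-q≤0 : (∀ U → p G U ℤ.≤ ℤ.0ℤ) → ∀ k (P : Partition n k) → q G P ℚ.≤ 0ℚ
  partitions-q≤0 p≤0 k P = from (q≤0⇔ P) (begin
    2 * ∑ eᵢ * V            ≡⟨ cong (_* V) (*-distribˡ-∑ 2 eᵢ) ⟩
    ∑ (λ i → 2 * eᵢ i) * V  ≡⟨ *-distribʳ-∑ V (λ i → 2 * eᵢ i) ⟩
    ∑ (λ i → 2 * eᵢ i * V)  ≤⟨ ∑-mono-≤ (λ i → to (p≤0⇔ G (part P i)) (p≤0 (part P i))) ⟩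
    ∑ (λ i → vol G (part P i) * vol G (part P i)) ∎)
    where
    open ℕP.≤-Reasoning
    eᵢ : Fin k → ℕ
    eᵢ i = e G (part P i)

  bipartitions⇒ab≤c² : (∀ (P : Partition n 2) → q G P ℚ.≤ 0ℚ) → ∀ U →
                       2 * e G U * (2 * e G (∁ U)) ≤ cut G U * cut G U
  -- Cases go through a helper: a `with` in this context (q≤0 in scope) exhausts memory.
  bipartitions⇒ab≤c² q≤0 U = by-cases (member-or-edgeless G U) (member-or-edgeless G (∁ U))
    where
    a b c : ℕ
    a = 2 * e G U
    b = 2 * e G (∁ U)
    c = cut G U

    straddling : (∃ λ v → lookup U v ≡ true) → (∃ λ w → lookup (∁ U) w ≡ true) → a * b ≤ c * c
    straddling U∋v (w , ∁U∋w) = bipartition-bound⇒ab≤c² a b c (begin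
      (a + b) * ((a + c) + (b + c))
        ≡⟨ cong₂ _*_ (two-halves (e G U) (e G (∁ U))) (sym (vol-full≡2e+cut+2e∁+cut G U)) ⟩
      2 * (e G U + (e G (∁ U) + 0)) * V
        ≤⟨ subst₂ (λ A B → 2 * (e G A + (e G B + 0)) * V
                           ≤ vol G A * vol G A + (vol G B * vol G B + 0))
                  (part-bipartition-0F U U∋v U∌w) (part-bipartition-1F U U∋v U∌w)
                  (to (q≤0⇔ P) (q≤0 P)) ⟩
      vol G U * vol G U + (vol G (∁ U) * vol G (∁ U) + 0)
        ≡⟨ cong₂ _+_ (cong₂ _*_ (vol≡2e+cut G U) (vol≡2e+cut G U))
                     (trans (ℕP.+-identityʳ (vol G (∁ U) * vol G (∁ U)))
                            (cong₂ _*_ (vol∁≡2e+cut G U) (vol∁≡2e+cut G U))) ⟩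
      (a + c) * (a + c) + (b + c) * (b + c) ∎)
      where
      open ℕP.≤-Reasoning
      U∌w : ∃ λ w → lookup U w ≡ false
      U∌w = w , not-injective (trans (sym (lookup-map w not U)) ∁U∋w)
      P : Partition n 2
      P = bipartition U U∋v U∌w
      two-halves : ∀ x y → 2 * x + 2 * y ≡ 2 * (x + (y + 0))
      two-halves = solve-∀

    by-cases : (∃ λ v → lookup U v ≡ true) ⊎ e G U ≡ 0 →
               (∃ λ w → lookup (∁ U) w ≡ true) ⊎ e G (∁ U) ≡ 0 → a * b ≤ c * c
    by-cases (inj₂ eU≡0) _ = subst (λ x → 2 * x * b ≤ c * c) (sym eU≡0) z≤n
    by-cases (inj₁ _) (inj₂ e∁U≡0) =
      subst (λ y → a * (2 * y) ≤ c * c) (sym e∁U≡0) (subst (_≤ c * c) (sym (ℕP.*-zeroʳ a)) z≤n)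
    by-cases (inj₁ U∋v) (inj₁ ∁U∋w) = straddling U∋v ∁U∋w

  bipartitions⇒p≤0 : (∀ (P : Partition n 2) → q G P ℚ.≤ 0ℚ) → ∀ U → p G U ℤ.≤ ℤ.0ℤ
  bipartitions⇒p≤0 q≤0 U = from (p≤0⇔ G U) (subst₂ _≤_
    (cong (2 * e G U *_) (sym (vol-full≡2e+cut+2e∁+cut G U)))
    (sym (cong₂ _*_ (vol≡2e+cut G U) (vol≡2e+cut G U)))
    (ab≤c²⇒part-bound (2 * e G U) (2 * e G (∁ U)) (cut G U) (bipartitions⇒ab≤c² q≤0 U)))

zero-modularity-partition : ∀ {n} (G : Graph n) .{{_ : NonZero (numEdges G)}} →
                            Σ ℕ λ k → Σ (Partition n k) λ P → q G P ≡ 0ℚ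
zero-modularity-partition {zero}  G {{()}}
zero-modularity-partition {suc n} G = 1 , whole , /-/-≡0 (m + 0) (V * V + 0) m (4 * m * m) balanced
  where
  m V : ℕ
  m = numEdges G
  V = vol G (full G)
  balanced : (m + 0) * (4 * m * m) ≡ (V * V + 0) * m
  balanced rewrite handshake G = identity m
    where
    identity : ∀ m → (m + 0) * (4 * m * m) ≡ ((2 * m) * (2 * m) + 0) * m
    identity = solve-∀

lemma1p8 : ∀ {n} (G : Graph n) .{{_ : NonZero (numEdges G)}}
    → (MaxModularityIs G 0ℚ ⇔ (∀ (P : Partition n 2) → q G P ℚ.≤ 0ℚ))
      × ((∀ (P : Partition n 2) → q G P ℚ.≤ 0ℚ) ⇔ (∀ (U : Subset n) → p G U ℤ.≤ ℤ.0ℤ))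
lemma1p8 G =
  mk⇔ (λ q*≡0 → proj₂ q*≡0 2)
      (λ q₂≤0 → zero-modularity-partition G , partitions-q≤0 G (bipartitions⇒p≤0 G q₂≤0))
  , mk⇔ (bipartitions⇒p≤0 G) (λ p≤0 → partitions-q≤0 G p≤0 2)
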